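{- Let $q$ be a prime power with $p=\operatorname{char}\mathbb F_q$, and let $f\in\mathbb F_q[X]$ be written as \[ f(X)=g_{p-1}(X^p-X)X^{p-1}+g_{p-2}(X^p-X)X^{p-2}+\cdots+g_0(X^p-X),\qquad g_i\in\mathbb F_q[X]. \] Let $0\le i\le p-1$. Then $\Delta^if=0$ if and only if $g_j=0$ for all $i\le j\le p-1$.
   Context: Every $f\in\mathbb F_q[X]$ has such a representation and the polynomials $g_0,\dots,g_{p-1}$ are uniquely determined by $f$. The difference operator is $\Delta f=f(X+1)-f(X)$, and $\Delta^i$ is its $i$-th iterate ($\Delta^0f=f$). -}

module Defs where

open import Level using (Level; _⊔_) renaming (suc to lsuc)
open import Algebra.Bundles using (CommutativeRing)
open import Data.Nat using (ℕ; zero; suc)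
open import Data.Fin using (Fin)
open import Data.List using (List; []; _∷_; map; replicate; _++_)
open import Data.List.Relation.Unary.All using (All)
open import Data.Product using (∃; _×_)
open import Relation.Nullary using (¬_)
open import Relation.Binary.PropositionalEquality using (_≡_)

-- A finite field: a commutative ring with 0 ≠ 1, inverses of nonzero
-- elements, and a finite carrier (a bijective enumeration by Fin size,
-- bijective up to the ring's setoid equality). size plays the role of q.
record FiniteField (c ℓ : Level) : Set (lsuc (c ⊔ ℓ)) where
  field
    commRing : CommutativeRing c ℓ
  open CommutativeRing commRing public
  field
    0≉1     : ¬ (0# ≈ 1#)
    inverse : ∀ x → ¬ (x ≈ 0#) → ∃ λ y → x * y ≈ 1#
    size    : ℕ
    enum    : Fin size → Carrier
    enum-surj : ∀ x → ∃ λ k → enum k ≈ x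
    enum-inj  : ∀ k l → enum k ≈ enum l → k ≡ l

  natCast : ℕ → Carrier
  natCast zero    = 0#
  natCast (suc n) = 1# + natCast n

  -- the field has characteristic p (p is assumed prime separately)
  HasCharacteristic : ℕ → Set ℓ
  HasCharacteristic p = natCast p ≈ 0#

-- Polynomials over a commutative ring, as coefficient lists
-- (lowest degree first).  Trailing zeros are allowed; a polynomial is
-- zero iff all its coefficients are ≈ 0.
module Poly {c ℓ : Level} (R : CommutativeRing c ℓ) where
  open CommutativeRing R

  Pol : Set c
  Pol = List Carrier

  _⊕_ : Pol → Pol → Pol
  []      ⊕ g       = g
  (a ∷ f) ⊕ []      = a ∷ f
  (a ∷ f) ⊕ (b ∷ g) = (a + b) ∷ (f ⊕ g)

  neg : Pol → Pol
  neg = map (-_)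

  scale : Carrier → Pol → Pol
  scale a = map (a *_)

  _⊗_ : Pol → Pol → Pol
  []      ⊗ g = []
  (a ∷ f) ⊗ g = scale a g ⊕ (0# ∷ (f ⊗ g))

  const : Carrier → Pol
  const a = a ∷ []

  Xpow : ℕ → Pol
  Xpow j = replicate j 0# ++ (1# ∷ [])

  compose : Pol → Pol → Pol
  compose []      h = []
  compose (a ∷ f) h = const a ⊕ (h ⊗ compose f h)

  Δ : Pol → Pol
  Δ f = compose f (1# ∷ 1# ∷ []) ⊕ neg f

  Δ^ : ℕ → Pol → Pol
  Δ^ zero    f = f
  Δ^ (suc i) f = Δ (Δ^ i f)

  IsZero : Pol → Set (c ⊔ ℓ)
  IsZero f = All (_≈ 0#) f

  ΣP : (n : ℕ) → (Fin n → Pol) → Pol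
  ΣP zero    F = []
  ΣP (suc n) F = F Fin.zero ⊕ ΣP n (λ j → F (Fin.suc j))

  ASpoly : ℕ → Pol
  ASpoly p = Xpow p ⊕ neg (Xpow 1)

  fromG : (p : ℕ) → (Fin p → Pol) → Pol
  fromG p g = ΣP p (λ j → compose (g j) (ASpoly p) ⊗ Xpow (Data.Fin.toℕ j))

-- Over a commutative ring of prime characteristic p, the binomial coefficients C(p,k), 0 < k < p,
-- vanish, so (X+1)^p - (X+1) = X^p - X: the polynomial A = X^p - X is invariant under
-- X ↦ X+1, hence Δ (g(A) X^j) = g(A) Δ(X^j).  Expanding Δ(X^j) = Σ_{k<j} C(j,k) X^k, Δ acts on
-- the family (g_0, …, g_{p-1}) by a strictly triangular matrix whose subdiagonal entries
-- C(k+1,k) = k+1 are units (Bézout with p), so each application of Δ raises by exactly one the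
-- index from which the g_j vanish.  This transfers to f because the g_j are determined by f:
-- if Σ_j g_j(A) X^j = 0, write it as r + A·u with deg r < p; comparing coefficients of degree
-- ≥ p shows that u is periodic with period p - 1, hence zero, so r = 0 too, and one recurses
-- on the quotients (g_j - g_j(0))/X.

module Submission where

open import Level using (Level)
open import Algebra.Bundles using (CommutativeRing)
open import Data.Empty using (⊥-elim)
open import Data.Fin as Fin using (Fin; toℕ)
import Data.Fin.Induction as Fin
import Data.Fin.Properties as Fin
open import Data.List using ([]; _∷_; length; drop)
open import Data.List.Properties using (length-drop)
open import Data.List.Relation.Unary.All using ([]; _∷_)
open import Data.Nat as ℕ using (ℕ; zero; suc; _≤_; _<_; z≤n; s≤s; nonTrivial⇒n>1)
import Data.Nat.Properties as ℕ
open import Data.Nat.Combinatorics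
  using (_C_; nCk+nC[k+1]≡[n+1]C[k+1]; k>n⇒nCk≡0; nCn≡1; nC1≡n; nCk≡nC[n∸k])
open import Data.Nat.Coprimality using (prime⇒coprime; coprime-Bézout)
open import Data.Nat.GCD using (module Bézout)
open import Data.Nat.GeneralisedArithmetic using (fold)
open import Data.Nat.Primality using (Prime; prime⇒nonTrivial)
open import Data.Product using (_,_; ∃)
open import Data.Sum using (inj₁; inj₂)
open import Function using (id; _∘_; case_of_; _⇔_; mk⇔; Equivalence)
open import Function.Construct.Composition using (_⇔-∘_)
open import Induction.WellFounded using (module All)
open import Relation.Binary.Bundles using (Setoid)
open import Relation.Binary.Definitions using (tri<; tri≈; tri>)
open import Relation.Binary.PropositionalEquality as ≡ using (_≡_; _≢_)
import Relation.Binary.Reasoning.Setoid as SetoidReasoning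
open import Relation.Nullary using (yes; no)

open import Defs

module _ where
  open import Data.Nat using (_+_; _*_)

  [k+1]*[n+1]C[k+1]≡[n+1]*nCk : ∀ n k → suc k * (suc n C suc k) ≡ suc n * (n C k)
  [k+1]*[n+1]C[k+1]≡[n+1]*nCk zero    zero    = ≡.refl
  [k+1]*[n+1]C[k+1]≡[n+1]*nCk zero    (suc k) = ℕ.*-zeroʳ (suc (suc k))
  [k+1]*[n+1]C[k+1]≡[n+1]*nCk (suc n) k = begin
    suc k * (suc (suc n) C suc k)
      ≡⟨ ≡.cong (suc k *_) (nCk+nC[k+1]≡[n+1]C[k+1] (suc n) k) ⟨
    suc k * (suc n C k + suc n C suc k)
      ≡⟨ ℕ.*-distribˡ-+ (suc k) (suc n C k) (suc n C suc k) ⟩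
    suc k * (suc n C k) + suc k * (suc n C suc k)
      ≡⟨ ≡.cong (suc k * (suc n C k) +_) ([k+1]*[n+1]C[k+1]≡[n+1]*nCk n k) ⟩
    (suc n C k + k * (suc n C k)) + suc n * (n C k)
      ≡⟨ ℕ.+-assoc (suc n C k) _ _ ⟩
    suc n C k + (k * (suc n C k) + suc n * (n C k))
      ≡⟨ ≡.cong (suc n C k +_) (lower k) ⟩
    suc (suc n) * (suc n C k) ∎
    where
    open ≡.≡-Reasoning
    lower : ∀ k → k * (suc n C k) + suc n * (n C k) ≡ suc n * (suc n C k)
    lower zero    = ≡.refl
    lower (suc k) = begin
      suc k * (suc n C suc k) + suc n * (n C suc k)
        ≡⟨ ≡.cong (_+ suc n * (n C suc k)) ([k+1]*[n+1]C[k+1]≡[n+1]*nCk n k) ⟩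
      suc n * (n C k) + suc n * (n C suc k)
        ≡⟨ ℕ.*-distribˡ-+ (suc n) (n C k) (n C suc k) ⟨
      suc n * (n C k + n C suc k)
        ≡⟨ ≡.cong (suc n *_) (nCk+nC[k+1]≡[n+1]C[k+1] n k) ⟩
      suc n * (suc n C suc k) ∎

  [n+1]Cn≡n+1 : ∀ n → suc n C n ≡ suc n
  [n+1]Cn≡n+1 n = ≡.trans (nCk≡nC[n∸k] (ℕ.n≤1+n n))
                          (≡.trans (≡.cong (suc n C_) (ℕ.m+n∸n≡m 1 n)) (nC1≡n (suc n)))

module PolynomialRing {c ℓ : Level} (R : CommutativeRing c ℓ) where
  open CommutativeRing R hiding (zero)
  open Poly R
  open import Algebra.Properties.Ring ring using (-0#≈0#; x∙y⁻¹≈ε⇒x≈y)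
  open import Algebra.Properties.CommutativeSemigroup +-commutativeSemigroup using (interchange)
  open import Algebra.Properties.Semiring.Mult semiring using (_×_; ×-homo-+)
  module ≈-Reasoning = SetoidReasoning setoid

  coeff : Pol → ℕ → Carrier
  coeff []      n       = 0#
  coeff (a ∷ f) zero    = a
  coeff (a ∷ f) (suc n) = coeff f n

  infix 4 _≋_
  record _≋_ (f g : Pol) : Set ℓ where
    constructor mk≋
    field at : ∀ n → coeff f n ≈ coeff g n
  open _≋_ public

  ≋-refl : ∀ {f} → f ≋ f
  ≋-refl = mk≋ λ _ → refl

  ≋-sym : ∀ {f g} → f ≋ g → g ≋ f
  ≋-sym e = mk≋ λ n → sym (at e n)

  ≋-trans : ∀ {f g h} → f ≋ g → g ≋ h → f ≋ h
  ≋-trans e e′ = mk≋ λ n → trans (at e n) (at e′ n)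

  ≋-setoid : Setoid c ℓ
  ≋-setoid = record
    { Carrier       = Pol
    ; _≈_           = _≋_
    ; isEquivalence = record { refl = ≋-refl ; sym = ≋-sym ; trans = ≋-trans }
    }

  module ≋-Reasoning = SetoidReasoning ≋-setoid

  ≋-reflexive : ∀ {f g} → f ≡ g → f ≋ g
  ≋-reflexive ≡.refl = ≋-refl

  ∷-cong : ∀ {a b f g} → a ≈ b → f ≋ g → a ∷ f ≋ b ∷ g
  ∷-cong a≈b f≋g = mk≋ λ where
    zero    → a≈b
    (suc n) → at f≋g n

  ∷≋[] : ∀ {a f} → a ≈ 0# → f ≋ [] → a ∷ f ≋ []
  ∷≋[] a≈0 f≋[] = mk≋ λ where
    zero    → a≈0
    (suc n) → at f≋[] n

  ∷-injectiveʳ : ∀ {a b f g} → a ∷ f ≋ b ∷ g → f ≋ g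
  ∷-injectiveʳ e = mk≋ λ n → at e (suc n)

  coeff-⊕ : ∀ f g n → coeff (f ⊕ g) n ≈ coeff f n + coeff g n
  coeff-⊕ []      g       n       = sym (+-identityˡ _)
  coeff-⊕ (a ∷ f) []      n       = sym (+-identityʳ _)
  coeff-⊕ (a ∷ f) (b ∷ g) zero    = refl
  coeff-⊕ (a ∷ f) (b ∷ g) (suc n) = coeff-⊕ f g n

  coeff-neg : ∀ f n → coeff (neg f) n ≈ - coeff f n
  coeff-neg []      n       = sym -0#≈0#
  coeff-neg (a ∷ f) zero    = refl
  coeff-neg (a ∷ f) (suc n) = coeff-neg f n

  coeff-scale : ∀ a f n → coeff (scale a f) n ≈ a * coeff f n
  coeff-scale a []      n       = sym (zeroʳ a)
  coeff-scale a (b ∷ f) zero    = refl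
  coeff-scale a (b ∷ f) (suc n) = coeff-scale a f n

  ⊕-cong : ∀ {f f′ g g′} → f ≋ f′ → g ≋ g′ → f ⊕ g ≋ f′ ⊕ g′
  ⊕-cong {f} {f′} {g} {g′} e e′ = mk≋ λ n → begin
    coeff (f ⊕ g) n       ≈⟨ coeff-⊕ f g n ⟩
    coeff f n + coeff g n ≈⟨ +-cong (at e n) (at e′ n) ⟩
    coeff f′ n + coeff g′ n ≈⟨ coeff-⊕ f′ g′ n ⟨
    coeff (f′ ⊕ g′) n     ∎
    where open ≈-Reasoning

  ⊕-congˡ : ∀ f {g g′} → g ≋ g′ → f ⊕ g ≋ f ⊕ g′
  ⊕-congˡ f = ⊕-cong (≋-refl {f})

  ⊕-assoc : ∀ f g h → (f ⊕ g) ⊕ h ≋ f ⊕ (g ⊕ h)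
  ⊕-assoc f g h = mk≋ λ n → begin
    coeff ((f ⊕ g) ⊕ h) n                 ≈⟨ trans (coeff-⊕ (f ⊕ g) h n) (+-congʳ (coeff-⊕ f g n)) ⟩
    (coeff f n + coeff g n) + coeff h n   ≈⟨ +-assoc _ _ _ ⟩
    coeff f n + (coeff g n + coeff h n)   ≈⟨ trans (coeff-⊕ f (g ⊕ h) n) (+-congˡ (coeff-⊕ g h n)) ⟨
    coeff (f ⊕ (g ⊕ h)) n                 ∎
    where open ≈-Reasoning

  ⊕-comm : ∀ f g → f ⊕ g ≋ g ⊕ f
  ⊕-comm f g = mk≋ λ n → trans (coeff-⊕ f g n) (trans (+-comm _ _) (sym (coeff-⊕ g f n)))

  ⊕-identityʳ : ∀ f → f ⊕ [] ≋ f
  ⊕-identityʳ f = mk≋ λ n → trans (coeff-⊕ f [] n) (+-identityʳ _)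

  neg-cong : ∀ {f g} → f ≋ g → neg f ≋ neg g
  neg-cong {f} {g} e = mk≋ λ n → trans (coeff-neg f n) (trans (-‿cong (at e n)) (sym (coeff-neg g n)))

  ⊕-inverseʳ : ∀ f → f ⊕ neg f ≋ []
  ⊕-inverseʳ f = mk≋ λ n → trans (coeff-⊕ f (neg f) n) (trans (+-congˡ (coeff-neg f n)) (-‿inverseʳ _))

  scale-cong : ∀ {a b f g} → a ≈ b → f ≋ g → scale a f ≋ scale b g
  scale-cong {a} {b} {f} {g} a≈b e = mk≋ λ n →
    trans (coeff-scale a f n) (trans (*-cong a≈b (at e n)) (sym (coeff-scale b g n)))

  scale-distrib-⊕ : ∀ a f g → scale a (f ⊕ g) ≋ scale a f ⊕ scale a g
  scale-distrib-⊕ a f g = mk≋ λ n → begin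
    coeff (scale a (f ⊕ g)) n     ≈⟨ trans (coeff-scale a (f ⊕ g) n) (*-congˡ (coeff-⊕ f g n)) ⟩
    a * (coeff f n + coeff g n)   ≈⟨ distribˡ a _ _ ⟩
    a * coeff f n + a * coeff g n ≈⟨ trans (coeff-⊕ (scale a f) (scale a g) n)
                                           (+-cong (coeff-scale a f n) (coeff-scale a g n)) ⟨
    coeff (scale a f ⊕ scale a g) n ∎
    where open ≈-Reasoning

  scale-assoc : ∀ a b f → scale a (scale b f) ≋ scale (a * b) f
  scale-assoc a b f = mk≋ λ n → begin
    coeff (scale a (scale b f)) n ≈⟨ trans (coeff-scale a (scale b f) n) (*-congˡ (coeff-scale b f n)) ⟩
    a * (b * coeff f n)           ≈⟨ *-assoc a b _ ⟨
    (a * b) * coeff f n           ≈⟨ coeff-scale (a * b) f n ⟨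
    coeff (scale (a * b) f) n     ∎
    where open ≈-Reasoning

  scale-identity : ∀ f → scale 1# f ≋ f
  scale-identity f = mk≋ λ n → trans (coeff-scale 1# f n) (*-identityˡ _)

  scale-zero : ∀ f → scale 0# f ≋ []
  scale-zero f = mk≋ λ n → trans (coeff-scale 0# f n) (zeroˡ _)

  scale-cancel : ∀ {a f} → (∀ {x} → a * x ≈ 0# → x ≈ 0#) → scale a f ≋ [] → f ≋ []
  scale-cancel {a} {f} cancel af≋[] = mk≋ λ n → cancel (trans (sym (coeff-scale a f n)) (at af≋[] n))

  shift-⊕ : ∀ f g → 0# ∷ (f ⊕ g) ≋ (0# ∷ f) ⊕ (0# ∷ g)
  shift-⊕ f g = ∷-cong (sym (+-identityʳ 0#)) ≋-refl

  ∷≋const⊕shift : ∀ a f → a ∷ f ≋ const a ⊕ (0# ∷ f)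
  ∷≋const⊕shift a f = ∷-cong (sym (+-identityʳ a)) ≋-refl

  ⊕-interchange : ∀ f g h k → (f ⊕ g) ⊕ (h ⊕ k) ≋ (f ⊕ h) ⊕ (g ⊕ k)
  ⊕-interchange f g h k = mk≋ λ n → begin
    coeff ((f ⊕ g) ⊕ (h ⊕ k)) n
      ≈⟨ trans (coeff-⊕ (f ⊕ g) (h ⊕ k) n) (+-cong (coeff-⊕ f g n) (coeff-⊕ h k n)) ⟩
    (coeff f n + coeff g n) + (coeff h n + coeff k n)
      ≈⟨ interchange _ _ _ _ ⟩
    (coeff f n + coeff h n) + (coeff g n + coeff k n)
      ≈⟨ trans (coeff-⊕ (f ⊕ h) (g ⊕ k) n) (+-cong (coeff-⊕ f h n) (coeff-⊕ g k n)) ⟨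
    coeff ((f ⊕ h) ⊕ (g ⊕ k)) n ∎
    where open ≈-Reasoning

  ⊗-congʳ : ∀ f {g g′} → g ≋ g′ → f ⊗ g ≋ f ⊗ g′
  ⊗-congʳ []      e = ≋-refl
  ⊗-congʳ (a ∷ f) e = ⊕-cong (scale-cong refl e) (∷-cong refl (⊗-congʳ f e))

  ⊗-zeroʳ : ∀ f → f ⊗ [] ≋ []
  ⊗-zeroʳ []      = ≋-refl
  ⊗-zeroʳ (a ∷ f) = ∷≋[] refl (⊗-zeroʳ f)

  ⊗-distribˡ-⊕ : ∀ f g h → f ⊗ (g ⊕ h) ≋ (f ⊗ g) ⊕ (f ⊗ h)
  ⊗-distribˡ-⊕ []      g h = ≋-refl
  ⊗-distribˡ-⊕ (a ∷ f) g h = begin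
    scale a (g ⊕ h) ⊕ (0# ∷ (f ⊗ (g ⊕ h)))
      ≈⟨ ⊕-cong (scale-distrib-⊕ a g h)
                (≋-trans (∷-cong refl (⊗-distribˡ-⊕ f g h)) (shift-⊕ (f ⊗ g) (f ⊗ h))) ⟩
    (scale a g ⊕ scale a h) ⊕ ((0# ∷ (f ⊗ g)) ⊕ (0# ∷ (f ⊗ h)))
      ≈⟨ ⊕-interchange (scale a g) (scale a h) (0# ∷ (f ⊗ g)) (0# ∷ (f ⊗ h)) ⟩
    (scale a g ⊕ (0# ∷ (f ⊗ g))) ⊕ (scale a h ⊕ (0# ∷ (f ⊗ h))) ∎
    where open ≋-Reasoning

  ⊗-scale : ∀ a f g → f ⊗ scale a g ≋ scale a (f ⊗ g)
  ⊗-scale a []      g = ≋-refl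
  ⊗-scale a (b ∷ f) g = begin
    scale b (scale a g) ⊕ (0# ∷ (f ⊗ scale a g))
      ≈⟨ ⊕-cong (≋-trans (scale-assoc b a g)
                         (≋-trans (scale-cong (*-comm b a) ≋-refl) (≋-sym (scale-assoc a b g))))
                (∷-cong (sym (zeroʳ a)) (⊗-scale a f g)) ⟩
    scale a (scale b g) ⊕ scale a (0# ∷ (f ⊗ g))
      ≈⟨ scale-distrib-⊕ a (scale b g) (0# ∷ (f ⊗ g)) ⟨
    scale a (scale b g ⊕ (0# ∷ (f ⊗ g))) ∎
    where open ≋-Reasoning

  ⊗-shift : ∀ f g → f ⊗ (0# ∷ g) ≋ 0# ∷ (f ⊗ g)
  ⊗-shift []      g = ≋-sym (∷≋[] refl ≋-refl)
  ⊗-shift (a ∷ f) g = ∷-cong (trans (+-congʳ (zeroʳ a)) (+-identityˡ 0#)) (⊕-cong ≋-refl (⊗-shift f g))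

  ⊗-const : ∀ f a → f ⊗ const a ≋ scale a f
  ⊗-const []      a = ≋-refl
  ⊗-const (b ∷ f) a = ∷-cong (trans (+-identityʳ _) (*-comm b a)) (⊗-const f a)

  ⊗-comm : ∀ f g → f ⊗ g ≋ g ⊗ f
  ⊗-comm []      g = ≋-sym (⊗-zeroʳ g)
  ⊗-comm (a ∷ f) g = begin
    scale a g ⊕ (0# ∷ (f ⊗ g))
      ≈⟨ ⊕-cong (⊗-const g a) (≋-trans (⊗-shift g f) (∷-cong refl (≋-sym (⊗-comm f g)))) ⟨
    (g ⊗ const a) ⊕ (g ⊗ (0# ∷ f))
      ≈⟨ ⊗-distribˡ-⊕ g _ _ ⟨
    g ⊗ (const a ⊕ (0# ∷ f))
      ≈⟨ ⊗-congʳ g (∷≋const⊕shift a f) ⟨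
    g ⊗ (a ∷ f) ∎
    where open ≋-Reasoning

  ⊗-congˡ : ∀ {f f′} g → f ≋ f′ → f ⊗ g ≋ f′ ⊗ g
  ⊗-congˡ {f} {f′} g e = ≋-trans (⊗-comm f g) (≋-trans (⊗-congʳ g e) (⊗-comm g f′))

  ⊗-distribʳ-⊕ : ∀ h f g → (f ⊕ g) ⊗ h ≋ (f ⊗ h) ⊕ (g ⊗ h)
  ⊗-distribʳ-⊕ h f g = ≋-trans (⊗-comm (f ⊕ g) h)
    (≋-trans (⊗-distribˡ-⊕ h f g) (⊕-cong (⊗-comm h f) (⊗-comm h g)))

  scale-⊗ : ∀ a f g → scale a f ⊗ g ≋ scale a (f ⊗ g)
  scale-⊗ a f g = ≋-trans (⊗-comm (scale a f) g)
    (≋-trans (⊗-scale a g f) (scale-cong refl (⊗-comm g f)))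

  shift-⊗ : ∀ f g → (0# ∷ f) ⊗ g ≋ 0# ∷ (f ⊗ g)
  shift-⊗ f g = ⊕-cong (scale-zero g) ≋-refl

  ⊗-assoc : ∀ f g h → (f ⊗ g) ⊗ h ≋ f ⊗ (g ⊗ h)
  ⊗-assoc []      g h = ≋-refl
  ⊗-assoc (a ∷ f) g h = begin
    (scale a g ⊕ (0# ∷ (f ⊗ g))) ⊗ h
      ≈⟨ ⊗-distribʳ-⊕ h (scale a g) _ ⟩
    (scale a g ⊗ h) ⊕ ((0# ∷ (f ⊗ g)) ⊗ h)
      ≈⟨ ⊕-cong (scale-⊗ a g h) (≋-trans (shift-⊗ (f ⊗ g) h) (∷-cong refl (⊗-assoc f g h))) ⟩
    scale a (g ⊗ h) ⊕ (0# ∷ (f ⊗ (g ⊗ h))) ∎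
    where open ≋-Reasoning

  const-⊗ : ∀ a g → const a ⊗ g ≋ scale a g
  const-⊗ a g = ≋-trans (⊕-cong ≋-refl (∷≋[] refl ≋-refl)) (⊕-identityʳ (scale a g))

  ⊗-identityˡ : ∀ g → const 1# ⊗ g ≋ g
  ⊗-identityˡ g = ≋-trans (const-⊗ 1# g) (scale-identity g)

  ⊗-identityʳ : ∀ f → f ⊗ const 1# ≋ f
  ⊗-identityʳ f = ≋-trans (⊗-const f 1#) (scale-identity f)

  polynomialRing : CommutativeRing c ℓ
  polynomialRing = record
    { Carrier = Pol ; _≈_ = _≋_ ; _+_ = _⊕_ ; _*_ = _⊗_ ; -_ = neg ; 0# = [] ; 1# = const 1#
    ; isCommutativeRing = record
      { isRing = record
        { +-isAbelianGroup = record
          { isGroup = record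
            { isMonoid = record
              { isSemigroup = record
                { isMagma = record { isEquivalence = Setoid.isEquivalence ≋-setoid ; ∙-cong = ⊕-cong }
                ; assoc = ⊕-assoc }
              ; identity = (λ _ → ≋-refl) , ⊕-identityʳ }
            ; inverse = (λ f → ≋-trans (⊕-comm (neg f) f) (⊕-inverseʳ f)) , ⊕-inverseʳ
            ; ⁻¹-cong = neg-cong }
          ; comm = ⊕-comm }
        ; *-cong = λ {f} {f′} {g} e e′ → ≋-trans (⊗-congˡ g e) (⊗-congʳ f′ e′)
        ; *-assoc = ⊗-assoc
        ; *-identity = ⊗-identityˡ , ⊗-identityʳ
        ; distrib = ⊗-distribˡ-⊕ , ⊗-distribʳ-⊕ }
      ; *-comm = ⊗-comm } }

  open import Algebra.Properties.Ring (CommutativeRing.ring polynomialRing) public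
    using ()
    renaming ( -‿distribˡ-* to neg-⊗ˡ ; -‿distribʳ-* to neg-⊗ʳ
             ; +-inverseʳ-unique to ⊕-inverseʳ-unique ; -‿+-comm to neg-⊕-comm )
  open import Algebra.Properties.Semiring.Sum (CommutativeRing.semiring polynomialRing) public
    using (sum; sum-cong-≋; ∑-comm; ∑-distrib-+; *-distribˡ-sum; *-distribʳ-sum; sum-replicate-zero)

  ⊕-neg-cancelˡ : ∀ f g h → (f ⊕ g) ⊕ neg (f ⊕ h) ≋ g ⊕ neg h
  ⊕-neg-cancelˡ f g h = begin
    (f ⊕ g) ⊕ neg (f ⊕ h)           ≈⟨ ⊕-congˡ (f ⊕ g) (neg-⊕-comm f h) ⟨
    (f ⊕ g) ⊕ (neg f ⊕ neg h)       ≈⟨ ⊕-interchange f g (neg f) (neg h) ⟩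
    (f ⊕ neg f) ⊕ (g ⊕ neg h)       ≈⟨ ⊕-cong (⊕-inverseʳ f) ≋-refl ⟩
    g ⊕ neg h                       ∎
    where open ≋-Reasoning

  ΣP≡sum : ∀ n (F : Fin n → Pol) → ΣP n F ≡ sum F
  ΣP≡sum zero    F = ≡.refl
  ΣP≡sum (suc n) F = ≡.cong (F Fin.zero ⊕_) (ΣP≡sum n (λ k → F (Fin.suc k)))

  sum-≋[] : ∀ {n} {F : Fin n → Pol} → (∀ k → F k ≋ []) → sum F ≋ []
  sum-≋[] {n} F≋[] = ≋-trans (sum-cong-≋ F≋[]) (sum-replicate-zero n)

  sum-single : ∀ {n} (F : Fin n → Pol) j → (∀ k → k ≢ j → F k ≋ []) → sum F ≋ F j
  sum-single F Fin.zero    others =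
    ≋-trans (⊕-congˡ (F Fin.zero) (sum-≋[] λ k → others (Fin.suc k) λ ())) (⊕-identityʳ _)
  sum-single F (Fin.suc j) others = ≋-trans (⊕-cong (others Fin.zero λ ()) ≋-refl)
    (sum-single (F ∘ Fin.suc) j λ k k≢j → others (Fin.suc k) (k≢j ∘ Fin.suc-injective))

  sum-shift : ∀ {n} (F : Fin n → Pol) → sum (λ k → 0# ∷ F k) ≋ 0# ∷ sum F
  sum-shift {zero}  F = ≋-sym (∷≋[] refl ≋-refl)
  sum-shift {suc n} F = ≋-trans (⊕-cong ≋-refl (sum-shift (F ∘ Fin.suc)))
                                (≋-sym (shift-⊕ (F Fin.zero) (sum (F ∘ Fin.suc))))

  ≋⇒≋[]⇔≋[] : ∀ {f g} → f ≋ g → f ≋ [] ⇔ g ≋ []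
  ≋⇒≋[]⇔≋[] f≋g = mk⇔ (≋-trans (≋-sym f≋g)) (≋-trans f≋g)

  IsZero⇒≋[] : ∀ {f} → IsZero f → f ≋ []
  IsZero⇒≋[] []         = ≋-refl
  IsZero⇒≋[] (a≈0 ∷ f₀) = ∷≋[] a≈0 (IsZero⇒≋[] f₀)

  ≋[]⇒IsZero : ∀ f → f ≋ [] → IsZero f
  ≋[]⇒IsZero []      e = []
  ≋[]⇒IsZero (a ∷ f) e = at e zero ∷ ≋[]⇒IsZero f (mk≋ λ n → at e (suc n))

  module _ (h : Pol) where

    compose-zero : ∀ {f} → f ≋ [] → compose f h ≋ []
    compose-zero {[]}    e = ≋-refl
    compose-zero {a ∷ f} e = ⊕-cong (∷≋[] (at e zero) ≋-refl)
      (≋-trans (⊗-congʳ h (compose-zero {f} (mk≋ λ n → at e (suc n)))) (⊗-zeroʳ h))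

    compose-congˡ : ∀ {f f′} → f ≋ f′ → compose f h ≋ compose f′ h
    compose-congˡ {[]}    {[]}     e = ≋-refl
    compose-congˡ {[]}    {b ∷ f′} e = ≋-sym (compose-zero (≋-sym e))
    compose-congˡ {a ∷ f} {[]}     e = compose-zero e
    compose-congˡ {a ∷ f} {b ∷ f′} e =
      ⊕-cong (∷-cong (at e zero) ≋-refl) (⊗-congʳ h (compose-congˡ (∷-injectiveʳ e)))

    compose-const : ∀ a → compose (const a) h ≋ const a
    compose-const a = ⊕-cong ≋-refl (⊗-zeroʳ h)

    compose-shift : ∀ f → compose (0# ∷ f) h ≋ h ⊗ compose f h
    compose-shift f = ⊕-cong (∷≋[] refl ≋-refl) ≋-refl

    compose-⊕ : ∀ f g → compose (f ⊕ g) h ≋ compose f h ⊕ compose g h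
    compose-⊕ []      g       = ≋-refl
    compose-⊕ (a ∷ f) []      = ≋-sym (⊕-identityʳ _)
    compose-⊕ (a ∷ f) (b ∷ g) = begin
      const (a + b) ⊕ (h ⊗ compose (f ⊕ g) h)
        ≈⟨ ⊕-cong (∷-cong refl (≋-sym (⊕-identityʳ [])))
                  (≋-trans (⊗-congʳ h (compose-⊕ f g)) (⊗-distribˡ-⊕ h (compose f h) (compose g h))) ⟩
      (const a ⊕ const b) ⊕ ((h ⊗ compose f h) ⊕ (h ⊗ compose g h))
        ≈⟨ ⊕-interchange (const a) (const b) (h ⊗ compose f h) (h ⊗ compose g h) ⟩
      (const a ⊕ (h ⊗ compose f h)) ⊕ (const b ⊕ (h ⊗ compose g h)) ∎
      where open ≋-Reasoning

    compose-scale : ∀ a f → compose (scale a f) h ≋ scale a (compose f h)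
    compose-scale a []      = ≋-refl
    compose-scale a (b ∷ f) = begin
      const (a * b) ⊕ (h ⊗ compose (scale a f) h)
        ≈⟨ ⊕-cong ≋-refl (≋-trans (⊗-congʳ h (compose-scale a f)) (⊗-scale a h (compose f h))) ⟩
      scale a (const b) ⊕ scale a (h ⊗ compose f h)
        ≈⟨ scale-distrib-⊕ a (const b) (h ⊗ compose f h) ⟨
      scale a (const b ⊕ (h ⊗ compose f h)) ∎
      where open ≋-Reasoning

    compose-⊗ : ∀ f g → compose (f ⊗ g) h ≋ compose f h ⊗ compose g h
    compose-⊗ []      g = ≋-refl
    compose-⊗ (a ∷ f) g = begin
      compose (scale a g ⊕ (0# ∷ (f ⊗ g))) h
        ≈⟨ compose-⊕ (scale a g) (0# ∷ (f ⊗ g)) ⟩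
      compose (scale a g) h ⊕ compose (0# ∷ (f ⊗ g)) h
        ≈⟨ ⊕-cong (compose-scale a g) (≋-trans (compose-shift (f ⊗ g)) (⊗-congʳ h (compose-⊗ f g))) ⟩
      scale a (compose g h) ⊕ (h ⊗ (compose f h ⊗ compose g h))
        ≈⟨ ⊕-cong (const-⊗ a (compose g h)) (⊗-assoc h (compose f h) (compose g h)) ⟨
      (const a ⊗ compose g h) ⊕ ((h ⊗ compose f h) ⊗ compose g h)
        ≈⟨ ⊗-distribʳ-⊕ (compose g h) (const a) (h ⊗ compose f h) ⟨
      (const a ⊕ (h ⊗ compose f h)) ⊗ compose g h ∎
      where open ≋-Reasoning

    compose-neg : ∀ f → compose (neg f) h ≋ neg (compose f h)
    compose-neg f = ⊕-inverseʳ-unique (compose f h) (compose (neg f) h)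
      (≋-trans (≋-sym (compose-⊕ f (neg f))) (compose-zero (⊕-inverseʳ f)))

    compose-sum : ∀ {n} (F : Fin n → Pol) → compose (sum F) h ≋ sum (λ k → compose (F k) h)
    compose-sum {zero}  F = ≋-refl
    compose-sum {suc n} F = ≋-trans (compose-⊕ (F Fin.zero) _) (⊕-cong ≋-refl (compose-sum (λ k → F (Fin.suc k))))

  compose-congʳ : ∀ f {h h′} → h ≋ h′ → compose f h ≋ compose f h′
  compose-congʳ []      e = ≋-refl
  compose-congʳ (a ∷ f) {h} {h′} e =
    ⊕-cong ≋-refl (≋-trans (⊗-congˡ (compose f h) e) (⊗-congʳ h′ (compose-congʳ f e)))

  compose-assoc : ∀ f g h → compose (compose f g) h ≋ compose f (compose g h)
  compose-assoc []      g h = ≋-refl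
  compose-assoc (a ∷ f) g h = begin
    compose (const a ⊕ (g ⊗ compose f g)) h
      ≈⟨ compose-⊕ h (const a) (g ⊗ compose f g) ⟩
    compose (const a) h ⊕ compose (g ⊗ compose f g) h
      ≈⟨ ⊕-cong (compose-const h a)
                (≋-trans (compose-⊗ h g (compose f g)) (⊗-congʳ (compose g h) (compose-assoc f g h))) ⟩
    const a ⊕ (compose g h ⊗ compose f (compose g h)) ∎
    where open ≋-Reasoning

  coeff-Xpow-≢ : ∀ {j k} → k ≢ j → coeff (Xpow j) k ≡ 0#
  coeff-Xpow-≢ {zero}  {zero}  k≢j = ⊥-elim (k≢j ≡.refl)
  coeff-Xpow-≢ {zero}  {suc k} k≢j = ≡.refl
  coeff-Xpow-≢ {suc j} {zero}  k≢j = ≡.refl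
  coeff-Xpow-≢ {suc j} {suc k} k≢j = coeff-Xpow-≢ (k≢j ∘ ≡.cong suc)

  coeff-Xpow-≡ : ∀ j → coeff (Xpow j) j ≡ 1#
  coeff-Xpow-≡ zero    = ≡.refl
  coeff-Xpow-≡ (suc j) = coeff-Xpow-≡ j

  coeff-Xpow⊗ : ∀ m u n → coeff (Xpow m ⊗ u) (m ℕ.+ n) ≈ coeff u n
  coeff-Xpow⊗ zero    u n = at (⊗-identityˡ u) n
  coeff-Xpow⊗ (suc m) u n = trans (at (shift-⊗ (Xpow m) u) (suc (m ℕ.+ n))) (coeff-Xpow⊗ m u n)

  X+1 : Pol
  X+1 = 1# ∷ 1# ∷ []

  X+1⊗ : ∀ u → X+1 ⊗ u ≋ u ⊕ (0# ∷ u)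
  X+1⊗ u = ⊕-cong (scale-identity u) (∷-cong refl (⊗-identityˡ u))

  coeff-binomial : ∀ n k → coeff (compose (Xpow n) X+1) k ≈ (n C k) × 1#
  coeff-binomial zero    zero    = trans (at (compose-const X+1 1#) zero) (sym (+-identityʳ 1#))
  coeff-binomial zero    (suc k) = at (compose-const X+1 1#) (suc k)
  coeff-binomial (suc n) k = trans (at (≋-trans (compose-shift X+1 (Xpow n)) (X+1⊗ _)) k) (step k)
    where
    u : Pol
    u = compose (Xpow n) X+1

    step : ∀ k → coeff (u ⊕ (0# ∷ u)) k ≈ (suc n C k) × 1#
    step zero    = trans (coeff-⊕ u (0# ∷ u) zero) (trans (+-identityʳ _) (coeff-binomial n zero))
    step (suc k) = begin
      coeff (u ⊕ (0# ∷ u)) (suc k)          ≈⟨ coeff-⊕ u (0# ∷ u) (suc k) ⟩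
      coeff u (suc k) + coeff u k           ≈⟨ +-cong (coeff-binomial n (suc k)) (coeff-binomial n k) ⟩
      (n C suc k) × 1# + (n C k) × 1#       ≈⟨ +-comm _ _ ⟩
      (n C k) × 1# + (n C suc k) × 1#       ≈⟨ ×-homo-+ 1# (n C k) (n C suc k) ⟨
      (n C k ℕ.+ n C suc k) × 1#            ≡⟨ ≡.cong (_× 1#) (nCk+nC[k+1]≡[n+1]C[k+1] n k) ⟩
      (suc n C suc k) × 1#                  ∎
      where open ≈-Reasoning

  fromCoefficients : ∀ m → (Fin m → Carrier) → Pol
  fromCoefficients m a = sum (λ k → scale (a k) (Xpow (toℕ k)))

  fromCoefficients-suc : ∀ m a → fromCoefficients (suc m) a ≋ a Fin.zero ∷ fromCoefficients m (a ∘ Fin.suc)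
  fromCoefficients-suc m a = begin
    scale (a Fin.zero) (1# ∷ []) ⊕ sum (λ k → scale (a (Fin.suc k)) (0# ∷ Xpow (toℕ k)))
      ≈⟨ ⊕-congˡ (a Fin.zero * 1# ∷ []) (sum-cong-≋ {m} λ k → ∷-cong (zeroʳ (a (Fin.suc k))) ≋-refl) ⟩
    (a Fin.zero * 1# ∷ []) ⊕ sum (λ k → 0# ∷ scale (a (Fin.suc k)) (Xpow (toℕ k)))
      ≈⟨ ⊕-congˡ (a Fin.zero * 1# ∷ []) (sum-shift (λ k → scale (a (Fin.suc k)) (Xpow (toℕ k)))) ⟩
    (a Fin.zero * 1# ∷ []) ⊕ (0# ∷ fromCoefficients m (a ∘ Fin.suc))
      ≈⟨ ∷-cong (trans (+-identityʳ _) (*-identityʳ _)) ≋-refl ⟩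
    a Fin.zero ∷ fromCoefficients m (a ∘ Fin.suc) ∎
    where open ≋-Reasoning

  coeff-fromCoefficients : ∀ m a (k : Fin m) → coeff (fromCoefficients m a) (toℕ k) ≈ a k
  coeff-fromCoefficients (suc m) a Fin.zero    = at (fromCoefficients-suc m a) zero
  coeff-fromCoefficients (suc m) a (Fin.suc k) =
    trans (at (fromCoefficients-suc m a) (suc (toℕ k))) (coeff-fromCoefficients m (a ∘ Fin.suc) k)

  coeff-fromCoefficients-≥ : ∀ m a n → m ≤ n → coeff (fromCoefficients m a) n ≈ 0#
  coeff-fromCoefficients-≥ zero    a n       _         = refl
  coeff-fromCoefficients-≥ (suc m) a (suc n) (s≤s m≤n) =
    trans (at (fromCoefficients-suc m a) (suc n)) (coeff-fromCoefficients-≥ m (a ∘ Fin.suc) n m≤n)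

  ≋-fromCoefficients : ∀ m f → (∀ n → m ≤ n → coeff f n ≈ 0#) →
                       f ≋ fromCoefficients m (λ k → coeff f (toℕ k))
  ≋-fromCoefficients m f high = mk≋ λ n → case ℕ.<-≤-connex n m of λ where
    (inj₁ n<m) → ≡.subst (λ i → coeff f i ≈ coeff (fromCoefficients m _) i) (Fin.toℕ-fromℕ< n<m)
                   (sym (coeff-fromCoefficients m _ (Fin.fromℕ< n<m)))
    (inj₂ m≤n) → trans (high n m≤n) (sym (coeff-fromCoefficients-≥ m _ n m≤n))

  -- Translation and the difference operator

  translate : Pol → Pol
  translate f = compose f X+1

  translate-compose : ∀ f {h} → translate h ≋ h → translate (compose f h) ≋ compose f h
  translate-compose f {h} e = ≋-trans (compose-assoc f h X+1) (compose-congʳ f e)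

  Δ-cong : ∀ {f g} → f ≋ g → Δ f ≋ Δ g
  Δ-cong e = ⊕-cong (compose-congˡ X+1 e) (neg-cong e)

  Δ-⊕ : ∀ f g → Δ (f ⊕ g) ≋ Δ f ⊕ Δ g
  Δ-⊕ f g = ≋-trans (⊕-cong (compose-⊕ X+1 f g) (≋-sym (neg-⊕-comm f g)))
                    (⊕-interchange (translate f) (translate g) (neg f) (neg g))

  Δ-sum : ∀ {n} (F : Fin n → Pol) → Δ (sum F) ≋ sum (Δ ∘ F)
  Δ-sum {zero}  F = ≋-refl
  Δ-sum {suc n} F = ≋-trans (Δ-⊕ (F Fin.zero) _) (⊕-cong ≋-refl (Δ-sum (F ∘ Fin.suc)))

  Δ-⊗-invariant : ∀ u v → translate u ≋ u → Δ (u ⊗ v) ≋ u ⊗ Δ v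
  Δ-⊗-invariant u v invariant = begin
    translate (u ⊗ v) ⊕ neg (u ⊗ v)
      ≈⟨ ⊕-cong (≋-trans (compose-⊗ X+1 u v) (⊗-congˡ (translate v) invariant)) (neg-⊗ʳ u v) ⟩
    (u ⊗ translate v) ⊕ (u ⊗ neg v)
      ≈⟨ ⊗-distribˡ-⊕ u (translate v) (neg v) ⟨
    u ⊗ Δ v ∎
    where open ≋-Reasoning

  coeff-ΔXpow : ∀ j k → coeff (Δ (Xpow j)) k ≈ (j C k) × 1# + - coeff (Xpow j) k
  coeff-ΔXpow j k = trans (coeff-⊕ (translate (Xpow j)) (neg (Xpow j)) k)
                          (+-cong (coeff-binomial j k) (coeff-neg (Xpow j) k))

  coeff-ΔXpow-≥ : ∀ {j k} → j ≤ k → coeff (Δ (Xpow j)) k ≈ 0#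
  coeff-ΔXpow-≥ {j} {k} j≤k with ℕ.m≤n⇒m<n∨m≡n j≤k
  ... | inj₁ j<k    = trans (coeff-ΔXpow j k)
                        (trans (+-cong (reflexive (≡.cong (_× 1#) (k>n⇒nCk≡0 j<k)))
                                       (-‿cong (reflexive (coeff-Xpow-≢ (ℕ.>⇒≢ j<k)))))
                               (trans (+-identityˡ _) -0#≈0#))
  ... | inj₂ ≡.refl = trans (coeff-ΔXpow j j)
                        (trans (+-cong (reflexive (≡.cong (_× 1#) (nCn≡1 j)))
                                       (-‿cong (reflexive (coeff-Xpow-≡ j))))
                               (trans (+-congʳ (+-identityʳ 1#)) (-‿inverseʳ 1#)))

  coeff-ΔXpow-pred : ∀ k → coeff (Δ (Xpow (suc k))) k ≈ suc k × 1#
  coeff-ΔXpow-pred k = trans (coeff-ΔXpow (suc k) k)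
    (trans (+-cong (reflexive (≡.cong (_× 1#) ([n+1]Cn≡n+1 k)))
                   (-‿cong (reflexive (coeff-Xpow-≢ (ℕ.<⇒≢ (ℕ.n<1+n k))))))
           (trans (+-congˡ -0#≈0#) (+-identityʳ _)))

  Δ-coords : ∀ p → (Fin p → Pol) → Fin p → Pol
  Δ-coords p g k = sum (λ j → scale (coeff (Δ (Xpow (toℕ j))) (toℕ k)) (g j))

  Δ-fromG : ∀ p → translate (ASpoly p) ≋ ASpoly p → ∀ g → Δ (fromG p g) ≋ fromG p (Δ-coords p g)
  Δ-fromG p invariant g = begin
    Δ (fromG p g)
      ≡⟨ ≡.cong Δ (ΣP≡sum p (λ j → G j ⊗ X j)) ⟩
    Δ (sum (λ j → G j ⊗ X j))
      ≈⟨ Δ-sum (λ j → G j ⊗ X j) ⟩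
    sum (λ j → Δ (G j ⊗ X j))
      ≈⟨ sum-cong-≋ {p} (λ j → Δ-⊗-invariant (G j) (X j) (translate-compose (g j) invariant)) ⟩
    sum (λ j → G j ⊗ Δ (X j))
      ≈⟨ sum-cong-≋ {p} (λ j → ⊗-congʳ (G j) (≋-fromCoefficients p (Δ (X j)) (λ n p≤n →
           coeff-ΔXpow-≥ (ℕ.≤-trans (ℕ.<⇒≤ (Fin.toℕ<n j)) p≤n)))) ⟩
    sum (λ j → G j ⊗ sum (λ k → scale (d j k) (X k)))
      ≈⟨ sum-cong-≋ {p} (λ j → ≋-trans (*-distribˡ-sum (G j) (λ k → scale (d j k) (X k)))
           (sum-cong-≋ {p} λ k → ≋-trans (⊗-scale (d j k) (G j) (X k))
                                          (≋-sym (scale-⊗ (d j k) (G j) (X k))))) ⟩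
    sum (λ j → sum (λ k → scale (d j k) (G j) ⊗ X k))
      ≈⟨ ∑-comm (λ j k → scale (d j k) (G j) ⊗ X k) ⟩
    sum (λ k → sum (λ j → scale (d j k) (G j) ⊗ X k))
      ≈⟨ sum-cong-≋ {p} (λ k → ≋-sym (*-distribʳ-sum (X k) (λ j → scale (d j k) (G j)))) ⟩
    sum (λ k → sum (λ j → scale (d j k) (G j)) ⊗ X k)
      ≈⟨ sum-cong-≋ {p} (λ k → ⊗-congˡ (X k) (≋-sym (≋-trans (compose-sum A (λ j → scale (d j k) (g j)))
           (sum-cong-≋ {p} λ j → compose-scale A (d j k) (g j))))) ⟩
    sum (λ k → compose (Δ-coords p g k) A ⊗ X k)
      ≡⟨ ΣP≡sum p (λ k → compose (Δ-coords p g k) A ⊗ X k) ⟨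
    fromG p (Δ-coords p g) ∎
    where
    open ≋-Reasoning
    A = ASpoly p
    G : Fin p → Pol
    G j = compose (g j) A
    X : Fin p → Pol
    X k = Xpow (toℕ k)
    d : Fin p → Fin p → Carrier
    d j k = coeff (Δ (X j)) (toℕ k)

  -- Uniqueness of the coordinates g_j of f = Σ_j g_j(X^p - X) X^j

  coeff-≥length : ∀ f {n} → length f ≤ n → coeff f n ≡ 0#
  coeff-≥length []      _         = ≡.refl
  coeff-≥length (a ∷ f) (s≤s len≤n) = coeff-≥length f len≤n

  ≋head∷tail : ∀ f → f ≋ coeff f 0 ∷ drop 1 f
  ≋head∷tail []      = ≋-sym (∷≋[] refl ≋-refl)
  ≋head∷tail (a ∷ f) = ≋-refl

  periodic⇒≋[] : ∀ d u → (∀ n → coeff u n ≈ coeff u (suc d ℕ.+ n)) → u ≋ []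
  periodic⇒≋[] d u periodic = mk≋ λ n →
    trans (iterate (length u) n)
          (reflexive (coeff-≥length u (ℕ.≤-trans (ℕ.m≤m*n (length u) (suc d)) (ℕ.m≤m+n _ n))))
    where
    iterate : ∀ t n → coeff u n ≈ coeff u (t ℕ.* suc d ℕ.+ n)
    iterate zero    n = refl
    iterate (suc t) n = trans (iterate t n) (trans (periodic (t ℕ.* suc d ℕ.+ n))
      (reflexive (≡.cong (coeff u) (≡.sym (ℕ.+-assoc (suc d) (t ℕ.* suc d) n)))))

  maxLength : ∀ {m} → (Fin m → Pol) → ℕ
  maxLength {zero}  h = 0
  maxLength {suc m} h = length (h Fin.zero) ℕ.⊔ maxLength (h ∘ Fin.suc)

  length≤maxLength : ∀ {m} (h : Fin m → Pol) k → length (h k) ≤ maxLength h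
  length≤maxLength h Fin.zero    = ℕ.m≤m⊔n _ _
  length≤maxLength h (Fin.suc k) = ℕ.≤-trans (length≤maxLength (h ∘ Fin.suc) k) (ℕ.m≤n⊔m _ _)

  -- p = q + 2, so that the period p - 1 of the quotient u below is positive.
  module _ (q : ℕ) where
    private
      p = suc (suc q)
      A = ASpoly p

    coeff-ASpoly⊗ : ∀ u n → coeff (A ⊗ u) (p ℕ.+ n) ≈ coeff u n + - coeff u (suc q ℕ.+ n)
    coeff-ASpoly⊗ u n = begin
      coeff (A ⊗ u) (p ℕ.+ n)
        ≈⟨ at (≋-trans (⊗-distribʳ-⊕ u (Xpow p) (neg (Xpow 1)))
                       (⊕-congˡ (Xpow p ⊗ u) (≋-sym (neg-⊗ˡ (Xpow 1) u)))) (p ℕ.+ n) ⟩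
      coeff ((Xpow p ⊗ u) ⊕ neg (Xpow 1 ⊗ u)) (p ℕ.+ n)
        ≈⟨ trans (coeff-⊕ (Xpow p ⊗ u) _ (p ℕ.+ n)) (+-congˡ (coeff-neg (Xpow 1 ⊗ u) (p ℕ.+ n))) ⟩
      coeff (Xpow p ⊗ u) (p ℕ.+ n) + - coeff (Xpow 1 ⊗ u) (1 ℕ.+ (suc q ℕ.+ n))
        ≈⟨ +-cong (coeff-Xpow⊗ p u n) (-‿cong (coeff-Xpow⊗ 1 u (suc q ℕ.+ n))) ⟩
      coeff u n + - coeff u (suc q ℕ.+ n) ∎
      where open ≈-Reasoning

    fromCoefficients⊕ASpoly⊗≋[]⇒≋[] : ∀ a u → fromCoefficients p a ⊕ (A ⊗ u) ≋ [] → u ≋ []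
    fromCoefficients⊕ASpoly⊗≋[]⇒≋[] a u vanishes = periodic⇒≋[] q u λ n → x∙y⁻¹≈ε⇒x≈y _ _ (begin
      coeff u n + - coeff u (suc q ℕ.+ n)
        ≈⟨ coeff-ASpoly⊗ u n ⟨
      coeff (A ⊗ u) (p ℕ.+ n)
        ≈⟨ +-identityˡ _ ⟨
      0# + coeff (A ⊗ u) (p ℕ.+ n)
        ≈⟨ +-congʳ (coeff-fromCoefficients-≥ p a (p ℕ.+ n) (ℕ.m≤m+n p n)) ⟨
      coeff (fromCoefficients p a) (p ℕ.+ n) + coeff (A ⊗ u) (p ℕ.+ n)
        ≈⟨ coeff-⊕ (fromCoefficients p a) (A ⊗ u) (p ℕ.+ n) ⟨
      coeff (fromCoefficients p a ⊕ (A ⊗ u)) (p ℕ.+ n)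
        ≈⟨ at vanishes (p ℕ.+ n) ⟩
      0# ∎)
      where open ≈-Reasoning

    fromCoefficients⊕ASpoly⊗≋[]⇒≈0 : ∀ a u → fromCoefficients p a ⊕ (A ⊗ u) ≋ [] → ∀ k → a k ≈ 0#
    fromCoefficients⊕ASpoly⊗≋[]⇒≈0 a u vanishes k =
      trans (sym (coeff-fromCoefficients p a k)) (at low≋[] (toℕ k))
      where
      low≋[] : fromCoefficients p a ≋ []
      low≋[] = ≋-trans (≋-sym (≋-trans (⊕-cong ≋-refl A⊗u≋[]) (⊕-identityʳ _))) vanishes
        where
        A⊗u≋[] : A ⊗ u ≋ []
        A⊗u≋[] = ≋-trans (⊗-congʳ A (fromCoefficients⊕ASpoly⊗≋[]⇒≋[] a u vanishes)) (⊗-zeroʳ A)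

    fromG-split : ∀ h → fromG p h ≋
                        fromCoefficients p (λ k → coeff (h k) 0) ⊕ (A ⊗ fromG p (λ k → drop 1 (h k)))
    fromG-split h = begin
      fromG p h
        ≡⟨ ΣP≡sum p (λ k → compose (h k) A ⊗ X k) ⟩
      sum (λ k → compose (h k) A ⊗ X k)
        ≈⟨ sum-cong-≋ {p} (λ k → ⊗-congˡ (X k) (compose-congˡ A (≋head∷tail (h k)))) ⟩
      sum (λ k → (const (a k) ⊕ (A ⊗ G k)) ⊗ X k)
        ≈⟨ sum-cong-≋ {p} (λ k → ≋-trans (⊗-distribʳ-⊕ (X k) (const (a k)) (A ⊗ G k))
                                         (⊕-cong (const-⊗ (a k) (X k)) (⊗-assoc A (G k) (X k)))) ⟩
      sum (λ k → scale (a k) (X k) ⊕ (A ⊗ (G k ⊗ X k)))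
        ≈⟨ ∑-distrib-+ (λ k → scale (a k) (X k)) (λ k → A ⊗ (G k ⊗ X k)) ⟩
      fromCoefficients p a ⊕ sum (λ k → A ⊗ (G k ⊗ X k))
        ≈⟨ ⊕-congˡ (fromCoefficients p a) (*-distribˡ-sum A (λ k → G k ⊗ X k)) ⟨
      fromCoefficients p a ⊕ (A ⊗ sum (λ k → G k ⊗ X k))
        ≡⟨ ≡.cong (λ t → fromCoefficients p a ⊕ (A ⊗ t)) (ΣP≡sum p (λ k → G k ⊗ X k)) ⟨
      fromCoefficients p a ⊕ (A ⊗ fromG p (λ k → drop 1 (h k))) ∎
      where
      open ≋-Reasoning
      a : Fin p → Carrier
      a k = coeff (h k) 0
      G : Fin p → Pol
      G k = compose (drop 1 (h k)) A
      X : Fin p → Pol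
      X k = Xpow (toℕ k)

    fromG≋[]⇒≋[]-bounded : ∀ N h → (∀ k → length (h k) ≤ N) → fromG p h ≋ [] → ∀ k → h k ≋ []
    fromG≋[]⇒≋[]-bounded zero    h short vanishes k =
      mk≋ λ n → reflexive (coeff-≥length (h k) (ℕ.≤-trans (short k) z≤n))
    fromG≋[]⇒≋[]-bounded (suc N) h short vanishes k =
      ≋-trans (≋head∷tail (h k))
              (∷≋[] (fromCoefficients⊕ASpoly⊗≋[]⇒≈0 a t split≋[] k)
                    (fromG≋[]⇒≋[]-bounded N (λ k → drop 1 (h k)) shorter
                                           (fromCoefficients⊕ASpoly⊗≋[]⇒≋[] a t split≋[]) k))
      where
      a : Fin p → Carrier
      a k = coeff (h k) 0
      t : Pol
      t = fromG p (λ k → drop 1 (h k))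
      split≋[] : fromCoefficients p a ⊕ (A ⊗ t) ≋ []
      split≋[] = ≋-trans (≋-sym (fromG-split h)) vanishes
      shorter : ∀ k → length (drop 1 (h k)) ≤ N
      shorter k = ≡.subst (_≤ N) (≡.sym (length-drop 1 (h k))) (ℕ.∸-monoˡ-≤ 1 (short k))

  fromG≋[]⇒≋[] : ∀ {p} → 1 < p → ∀ h → fromG p h ≋ [] → ∀ k → h k ≋ []
  fromG≋[]⇒≋[] {suc (suc q)} (s≤s (s≤s z≤n)) h =
    fromG≋[]⇒≋[]-bounded q (maxLength h) h (length≤maxLength h)

  VanishesFrom : ∀ {n} → ℕ → (Fin n → Pol) → Set ℓ
  VanishesFrom m h = ∀ j → m ≤ toℕ j → h j ≋ []

  fromG≋[]⇔VanishesFrom0 : ∀ {p} → 1 < p → ∀ h → fromG p h ≋ [] ⇔ VanishesFrom 0 h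
  fromG≋[]⇔VanishesFrom0 {p} 1<p h = mk⇔
    (λ fromG≋[] j _ → fromG≋[]⇒≋[] 1<p h fromG≋[] j)
    (λ h≋[] → ≋-trans (≋-reflexive (ΣP≡sum p _))
                      (sum-≋[] λ k → ⊗-congˡ (Xpow (toℕ k)) (compose-zero (ASpoly p) (h≋[] k z≤n))))

module PrimeCharacteristic {c ℓ : Level} (R : CommutativeRing c ℓ) where
  open CommutativeRing R hiding (zero)
  open import Algebra.Properties.Ring ring using (-‿distribˡ-*; +-inverseʳ-unique; -‿involutive)
  open import Algebra.Properties.Semiring.Mult semiring using (_×_; ×1-homo-*)

  module _ {p : ℕ} (p-prime : Prime p) (char : p × 1# ≈ 0#) where

    multiple×1≈0 : ∀ x → (x ℕ.* p) × 1# ≈ 0#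
    multiple×1≈0 x = trans (×1-homo-* x p) (trans (*-congˡ char) (zeroʳ _))

    ×1-invertible : ∀ {j} → 0 < j → j < p → ∃ λ y → y * (j × 1#) ≈ 1#
    ×1-invertible {j@(suc _)} _ j<p with coprime-Bézout (prime⇒coprime p-prime j<p)
    ... | Bézout.+- x y eq = - (y × 1#) , (begin
      - (y × 1#) * (j × 1#)    ≈⟨ -‿distribˡ-* _ _ ⟨
      - ((y × 1#) * (j × 1#))  ≈⟨ -‿cong (×1-homo-* y j) ⟨
      - ((y ℕ.* j) × 1#)       ≈⟨ -‿cong (+-inverseʳ-unique 1# _ 1+yj≈0) ⟩
      - - 1#                   ≈⟨ -‿involutive 1# ⟩
      1#                       ∎)
      where
      open SetoidReasoning setoid
      1+yj≈0 : 1# + (y ℕ.* j) × 1# ≈ 0#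
      1+yj≈0 = trans (reflexive (≡.cong (_× 1#) eq)) (multiple×1≈0 x)
    ... | Bézout.-+ x y eq = y × 1# , (begin
      (y × 1#) * (j × 1#)      ≈⟨ ×1-homo-* y j ⟨
      (y ℕ.* j) × 1#           ≡⟨ ≡.cong (_× 1#) eq ⟨
      1# + (x ℕ.* p) × 1#      ≈⟨ +-congˡ (multiple×1≈0 x) ⟩
      1# + 0#                  ≈⟨ +-identityʳ 1# ⟩
      1#                       ∎)
      where open SetoidReasoning setoid

    ×1-cancel : ∀ {j x} → 0 < j → j < p → (j × 1#) * x ≈ 0# → x ≈ 0#
    ×1-cancel {j} {x} 0<j j<p jx≈0 with ×1-invertible 0<j j<p
    ... | y , yj≈1 = begin
      x                    ≈⟨ *-identityˡ x ⟨
      1# * x               ≈⟨ *-congʳ yj≈1 ⟨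
      (y * (j × 1#)) * x   ≈⟨ *-assoc y _ x ⟩
      y * ((j × 1#) * x)   ≈⟨ *-congˡ jx≈0 ⟩
      y * 0#               ≈⟨ zeroʳ y ⟩
      0#                   ∎
      where open SetoidReasoning setoid

  C×1≈0 : ∀ {p k} → Prime p → p × 1# ≈ 0# → 0 < k → k < p → (p C k) × 1# ≈ 0#
  C×1≈0 {suc n} {suc k} p-prime char 0<k k<p = ×1-cancel p-prime char 0<k k<p (begin
    (suc k × 1#) * ((suc n C suc k) × 1#)   ≈⟨ ×1-homo-* (suc k) (suc n C suc k) ⟨
    (suc k ℕ.* (suc n C suc k)) × 1#         ≡⟨ ≡.cong (_× 1#) ([k+1]*[n+1]C[k+1]≡[n+1]*nCk n k) ⟩
    (suc n ℕ.* (n C k)) × 1#                 ≈⟨ ×1-homo-* (suc n) (n C k) ⟩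
    (suc n × 1#) * ((n C k) × 1#)            ≈⟨ *-congʳ char ⟩
    0# * ((n C k) × 1#)                      ≈⟨ zeroˡ _ ⟩
    0#                                       ∎)
    where open SetoidReasoning setoid

  module _ {p : ℕ} (p-prime : Prime p) (char : p × 1# ≈ 0#) where
    open Poly R
    open PolynomialRing R

    1<p : 1 < p
    1<p = nonTrivial⇒n>1 p {{prime⇒nonTrivial p-prime}}

    coeff-binomial-p : ∀ n → 0 < n → (p C n) × 1# ≈ coeff (Xpow p) n
    coeff-binomial-p n 0<n with ℕ.<-cmp n p
    ... | tri< n<p _ _ = trans (C×1≈0 p-prime char 0<n n<p) (reflexive (≡.sym (coeff-Xpow-≢ (ℕ.<⇒≢ n<p))))
    ... | tri≈ _ ≡.refl _ = trans (reflexive (≡.cong (_× 1#) (nCn≡1 p)))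
                                  (trans (+-identityʳ 1#) (reflexive (≡.sym (coeff-Xpow-≡ p))))
    ... | tri> _ _ n>p =
      reflexive (≡.trans (≡.cong (_× 1#) (k>n⇒nCk≡0 n>p)) (≡.sym (coeff-Xpow-≢ (ℕ.>⇒≢ n>p))))

    translate-Xpow-p : translate (Xpow p) ≋ const 1# ⊕ Xpow p
    translate-Xpow-p = mk≋ λ where
      zero    → trans (coeff-binomial p zero)
                      (trans (+-congˡ (reflexive (≡.sym (coeff-Xpow-≢ (ℕ.<⇒≢ (ℕ.<-trans (s≤s z≤n) 1<p))))))
                             (sym (coeff-⊕ (const 1#) (Xpow p) zero)))
      (suc n) → trans (coeff-binomial p (suc n))
                      (trans (coeff-binomial-p (suc n) (s≤s z≤n))
                             (trans (sym (+-identityˡ _)) (sym (coeff-⊕ (const 1#) (Xpow p) (suc n)))))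

    translate-Xpow-1 : translate (Xpow 1) ≋ const 1# ⊕ Xpow 1
    translate-Xpow-1 = begin
      compose (0# ∷ 1# ∷ []) X+1    ≈⟨ compose-shift X+1 (Xpow 0) ⟩
      X+1 ⊗ compose (1# ∷ []) X+1   ≈⟨ ⊗-congʳ X+1 (compose-const X+1 1#) ⟩
      X+1 ⊗ const 1#                ≈⟨ ⊗-identityʳ X+1 ⟩
      X+1                           ≈⟨ ∷-cong (sym (+-identityʳ 1#)) ≋-refl ⟩
      const 1# ⊕ Xpow 1             ∎
      where open ≋-Reasoning

    translate-ASpoly : translate (ASpoly p) ≋ ASpoly p
    translate-ASpoly = begin
      translate (Xpow p ⊕ neg (Xpow 1))
        ≈⟨ ≋-trans (compose-⊕ X+1 (Xpow p) (neg (Xpow 1)))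
                   (⊕-congˡ (translate (Xpow p)) (compose-neg X+1 (Xpow 1))) ⟩
      translate (Xpow p) ⊕ neg (translate (Xpow 1))
        ≈⟨ ⊕-cong translate-Xpow-p (neg-cong translate-Xpow-1) ⟩
      (const 1# ⊕ Xpow p) ⊕ neg (const 1# ⊕ Xpow 1)
        ≈⟨ ⊕-neg-cancelˡ (const 1#) (Xpow p) (Xpow 1) ⟩
      Xpow p ⊕ neg (Xpow 1) ∎
      where open ≋-Reasoning

    Δ-coords-VanishesFrom : ∀ m h → VanishesFrom m (Δ-coords p h) ⇔ VanishesFrom (suc m) h
    Δ-coords-VanishesFrom m h = mk⇔ to from
      where
      d : Fin p → Fin p → Carrier
      d j k = coeff (Δ (Xpow (toℕ j))) (toℕ k)

      from : VanishesFrom (suc m) h → VanishesFrom m (Δ-coords p h)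
      from h≋[] k m≤k = sum-≋[] λ j → case toℕ j ℕ.≤? toℕ k of λ where
        (yes j≤k) → ≋-trans (scale-cong (coeff-ΔXpow-≥ j≤k) ≋-refl) (scale-zero (h j))
        (no j≰k)  → scale-cong refl (h≋[] j (ℕ.≤-trans (s≤s m≤k) (ℕ.≰⇒> j≰k)))

      to : VanishesFrom m (Δ-coords p h) → VanishesFrom (suc m) h
      to Δh≋[] = All.wfRec Fin.>-wellFounded ℓ (λ j → suc m ≤ toℕ j → h j ≋ []) step
        where
        step : ∀ j → (∀ {i} → i Fin.> j → suc m ≤ toℕ i → h i ≋ []) → suc m ≤ toℕ j → h j ≋ []
        step (Fin.suc i) above (s≤s m≤i) = scale-cancel cancel single
          where
          k : Fin p
          k = Fin.inject₁ i

          d≈j : d (Fin.suc i) k ≈ suc (toℕ i) × 1#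
          d≈j = trans (reflexive (≡.cong (coeff (Δ (Xpow (suc (toℕ i))))) (Fin.toℕ-inject₁ i)))
                      (coeff-ΔXpow-pred (toℕ i))

          cancel : ∀ {x} → d (Fin.suc i) k * x ≈ 0# → x ≈ 0#
          cancel dx≈0 =
            ×1-cancel p-prime char (s≤s z≤n) (Fin.toℕ<n (Fin.suc i)) (trans (*-congʳ (sym d≈j)) dx≈0)

          others : ∀ j → j ≢ Fin.suc i → scale (d j k) (h j) ≋ []
          others j j≢ with toℕ j ℕ.≤? toℕ k
          ... | yes j≤k = ≋-trans (scale-cong (coeff-ΔXpow-≥ j≤k) ≋-refl) (scale-zero (h j))
          ... | no j≰k  = scale-cong refl (above j>i+1 (ℕ.≤-trans (s≤s m≤i) (ℕ.<⇒≤ j>i+1)))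
            where
            j>i+1 : j Fin.> Fin.suc i
            j>i+1 = ℕ.≤∧≢⇒< (≡.subst (λ n → suc n ≤ toℕ j) (Fin.toℕ-inject₁ i) (ℕ.≰⇒> j≰k))
                            (λ eq → j≢ (Fin.toℕ-injective (≡.sym eq)))

          single : scale (d (Fin.suc i) k) (h (Fin.suc i)) ≋ []
          single = ≋-trans (≋-sym (sum-single _ (Fin.suc i) others))
                           (Δh≋[] k (≡.subst (m ≤_) (≡.sym (Fin.toℕ-inject₁ i)) m≤i))

    Δ-coords^-VanishesFrom : ∀ i m h → VanishesFrom m (fold h (Δ-coords p) i) ⇔ VanishesFrom (i ℕ.+ m) h
    Δ-coords^-VanishesFrom zero    m h = mk⇔ id id
    Δ-coords^-VanishesFrom (suc i) m h =
      ≡.subst (λ n → VanishesFrom (suc m) (fold h (Δ-coords p) i) ⇔ VanishesFrom n h) (ℕ.+-suc i m)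
              (Δ-coords^-VanishesFrom i (suc m) h)
      ⇔-∘ Δ-coords-VanishesFrom m (fold h (Δ-coords p) i)

    Δ^-fromG : ∀ i g → Δ^ i (fromG p g) ≋ fromG p (fold g (Δ-coords p) i)
    Δ^-fromG zero    g = ≋-refl
    Δ^-fromG (suc i) g = ≋-trans (Δ-cong (Δ^-fromG i g)) (Δ-fromG p translate-ASpoly _)

    Δ^-fromG≋[]⇔ : ∀ g i → Δ^ i (fromG p g) ≋ [] ⇔ VanishesFrom i g
    Δ^-fromG≋[]⇔ g i =
      ≡.subst (λ n → VanishesFrom 0 (fold g (Δ-coords p) i) ⇔ VanishesFrom n g) (ℕ.+-identityʳ i)
              (Δ-coords^-VanishesFrom i 0 g)
      ⇔-∘ (fromG≋[]⇔VanishesFrom0 1<p (fold g (Δ-coords p) i)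
      ⇔-∘ ≋⇒≋[]⇔≋[] (Δ^-fromG i g))

    Δ^-fromG-IsZero⇔ : ∀ g i → IsZero (Δ^ i (fromG p g)) ⇔ (∀ j → i ≤ toℕ j → IsZero (g j))
    Δ^-fromG-IsZero⇔ g i = mk⇔
      (λ Δⁱf≈0 j i≤j → ≋[]⇒IsZero (g j) (to (Δ^-fromG≋[]⇔ g i) (IsZero⇒≋[] Δⁱf≈0) j i≤j))
      (λ g≈0 → ≋[]⇒IsZero _ (from (Δ^-fromG≋[]⇔ g i) λ j i≤j → IsZero⇒≋[] (g≈0 j i≤j)))
      where open Equivalence

lemma5p1 : ∀ {c ℓ} (F : FiniteField c ℓ) (p : ℕ) → Prime p →
             FiniteField.HasCharacteristic F p →
             (g : Fin p → Poly.Pol (FiniteField.commRing F)) (i : ℕ) → i < p →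
             Poly.IsZero (FiniteField.commRing F)
               (Poly.Δ^ (FiniteField.commRing F) i (Poly.fromG (FiniteField.commRing F) p g))
             ⇔ (∀ (j : Fin p) → i ≤ toℕ j → Poly.IsZero (FiniteField.commRing F) (g j))
lemma5p1 F p p-prime char g i _ =
  PrimeCharacteristic.Δ^-fromG-IsZero⇔ commRing p-prime (≡.subst (_≈ 0#) (natCast≡×1 p) char) g i
  where
  open FiniteField F
  open import Algebra.Properties.Semiring.Mult semiring using (_×_)
  natCast≡×1 : ∀ n → natCast n ≡ n × 1#
  natCast≡×1 zero    = ≡.refl
  natCast≡×1 (suc n) = ≡.cong (1# +_) (natCast≡×1 n)
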